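{- Let $M$ be a two-counter machine and let $s\in\mathcal{S}\Sigma_M$ be a configuration with $s\le T_M$. Suppose that the inclusion of languages $$l\big(s_rR_M^*\big)\subseteq l\big(\Sigma_M^*(C_M+c_1)_r+\Sigma_M^*\Sigma_M^{\neq}\ddot\Sigma_M^*\big)$$ holds in $\mathcal{L}\ddot\Sigma_M$. If $s\to_{R_M}^* c_x$ for some $x\in\{0,1\}$, then $x=1$.
   Context: Pre-Kleene algebra: constants $0,1$, operations $+,\cdot,{}^*$ with $(+,0)$ a commutative idempotent monoid, $(\cdot,1)$ a monoid, two-sided distributivity, $0$ absorbing, and $x^*=1+xx^*$; order $x\le y$ iff $x+y=y$. A commutable set is a set with a reflexive symmetric relation $\sim$ (discrete if $\sim$ is equality). $\mathcal{S}Y$: strings over $Y$ modulo $xy=yx$ for $x\sim y$. $\mathcal{T}Y$: free pre-Kleene algebra on $Y$ subject to $xy=yx$ for $x\sim y$. $\mathcal{L}Y$: smallest subalgebra of the power set of $\mathcal{S}Y$ (operations $\emptyset,\{1\},\cup$, concatenation, $A^*=\bigcup_nA^n$) containing singletons; $l:\mathcal{T}Y\to\mathcal{L}Y$ the morphism with $l(y)=\{y\}$. For strings $s$ and terms $e$, $s\le e$ is the order in $\mathcal{T}Y$. A finite set of elements is identified with their sum. $\ddot Y$ is the set $\{y_l\}\cup\{y_r\}$ ($y\in Y$) with $y_l\sim y'_r$ always, $y_l\sim y'_l$ iff $y\sim y'$, $y_r\sim y'_r$ iff $y\sim y'$. The morphisms $(-)_l,(-)_r:\mathcal{T}Y\to\mathcal{T}\ddot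 Y$ send $y$ to $y_l$, resp. $y_r$; a term or string $e$ over $Y$ written without subscript is regarded in $\mathcal{T}\ddot Y$ via $y\mapsto y_ly_r$. For strings $s,s'$ over $Y$ and $e\in\mathcal{T}\ddot Y$, $s\to_e s'$ means $s_ls'_r\le e$; $\to_e^*$ is its reflexive transitive closure. A two-counter machine $M=(Q_M,\dot q,\iota)$ has a finite set of states $Q_M$, initial state $\dot q$, and $\iota:Q_M\to I_M$ where instructions are $\mathrm{Inc}(r,q)$, $\mathrm{If}(r,q,q')$ ($r\in\{1,2\}$, $q,q'\in Q_M$) and $\mathrm{Halt}(x)$ ($x\in\{0,1\}$). $\Sigma_M=Q_M\uplus\{a,b,c_0,c_1\}$ is discrete; $C_M=a^*b^*Q_M\in\mathcal{T}\Sigma_M$ and $T_M=C_M+c_0+c_1$. In $\mathcal{T}\ddot\Sigma_M$: $[\![\mathrm{Inc}(1,q)]\!]=a_r(a_la_r)^*(b_lb_r)^*q_r$, $[\![\mathrm{Inc}(2,q)]\!]=(a_la_r)^*b_r(b_lb_r)^*q_r$, $[\![\mathrm{If}(1,q_1,q_2)]\!]=(b_lb_r)^*(q_1)_r+a_l(a_la_r)^*(b_lb_r)^*(q_2)_r$, $[\![\mathrm{If}(2,q_1,q_2)]\!]=(a_la_r)^*(q_1)_r+(a_la_r)^*b_l(b_lb_r)^*(q_2)_r$, $[\![\mathrm{Halt}(x)]\!]=(c_x)_r$, and $R_M=\sum_{q\in Q_M}[\![\iota(q)]\!]q_l$. Also $\Sigma_M^*=(\sum_{x\in\Sigma_M}x_lx_r)^*$,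 $\ddot\Sigma_M^*=(\sum_{y\in\ddot\Sigma_M}y)^*$, and $\Sigma_M^{\neq}=\sum_{x,y\in\Sigma_M,x\neq y}x_ly_r$. -}

module Defs where

open import Data.Nat using (ℕ; zero; suc)
open import Data.Fin as Fin using (Fin)
open import Data.List using (List; []; _∷_; _++_; [_]; map; foldr; filter; concatMap)
open import Data.Product using (Σ; ∃; _×_; _,_; proj₁; proj₂)
open import Data.Sum using (_⊎_; inj₁; inj₂)
open import Data.Empty using (⊥)
open import Data.Unit using (⊤)
open import Relation.Nullary using (yes; no; ¬_; ¬?)
open import Relation.Binary.Definitions using (DecidableEquality)
open import Relation.Binary.PropositionalEquality using (_≡_; refl)
open import Relation.Binary.Construct.Closure.ReflexiveTransitive using (Star)

infixl 6 _⊕_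
infixl 7 _⊗_
infix 8 _⋆

data Tm (A : Set) : Set where
  𝟘 𝟙 : Tm A
  var : A → Tm A
  _⊕_ _⊗_ : Tm A → Tm A → Tm A
  _⋆ : Tm A → Tm A

-- finite sums (a finite set of elements identified with their sum)
∑ : ∀ {A} → List (Tm A) → Tm A
∑ = foldr _⊕_ 𝟘

str : ∀ {A} → List A → Tm A
str = foldr (λ x e → var x ⊗ e) 𝟙

subst : ∀ {A B} → (A → Tm B) → Tm A → Tm B
subst σ 𝟘 = 𝟘
subst σ 𝟙 = 𝟙
subst σ (var x) = σ x
subst σ (e ⊕ f) = subst σ e ⊕ subst σ f
subst σ (e ⊗ f) = subst σ e ⊗ subst σ f
subst σ (e ⋆) = subst σ e ⋆

-- 𝒯Y for a commutable set (A, R): free pre-Kleene algebra on A subject to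
-- xy = yx for x ∼ y, presented as terms modulo the generated congruence.

module Free {A : Set} (R : A → A → Set) where

  infix 4 _≈_ _≤_

  data _≈_ : Tm A → Tm A → Set where
    ≈-refl  : ∀ {e} → e ≈ e
    ≈-sym   : ∀ {e f} → e ≈ f → f ≈ e
    ≈-trans : ∀ {e f g} → e ≈ f → f ≈ g → e ≈ g
    ⊕-cong  : ∀ {e e' f f'} → e ≈ e' → f ≈ f' → e ⊕ f ≈ e' ⊕ f'
    ⊗-cong  : ∀ {e e' f f'} → e ≈ e' → f ≈ f' → e ⊗ f ≈ e' ⊗ f'
    ⋆-cong  : ∀ {e e'} → e ≈ e' → e ⋆ ≈ e' ⋆
    ⊕-assoc : ∀ {e f g} → (e ⊕ f) ⊕ g ≈ e ⊕ (f ⊕ g)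
    ⊕-comm  : ∀ {e f} → e ⊕ f ≈ f ⊕ e
    ⊕-idem  : ∀ {e} → e ⊕ e ≈ e
    ⊕-idˡ   : ∀ {e} → 𝟘 ⊕ e ≈ e
    ⊗-assoc : ∀ {e f g} → (e ⊗ f) ⊗ g ≈ e ⊗ (f ⊗ g)
    ⊗-idˡ   : ∀ {e} → 𝟙 ⊗ e ≈ e
    ⊗-idʳ   : ∀ {e} → e ⊗ 𝟙 ≈ e
    distribˡ : ∀ {e f g} → e ⊗ (f ⊕ g) ≈ (e ⊗ f) ⊕ (e ⊗ g)
    distribʳ : ∀ {e f g} → (f ⊕ g) ⊗ e ≈ (f ⊗ e) ⊕ (g ⊗ e)
    zeroˡ   : ∀ {e} → 𝟘 ⊗ e ≈ 𝟘
    zeroʳ   : ∀ {e} → e ⊗ 𝟘 ≈ 𝟘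
    unfold  : ∀ {e} → e ⋆ ≈ 𝟙 ⊕ e ⊗ (e ⋆)
    comm    : ∀ {x y} → R x y → var x ⊗ var y ≈ var y ⊗ var x

  _≤_ : Tm A → Tm A → Set
  e ≤ f = e ⊕ f ≈ f

module Lang {A : Set} (R : A → A → Set) where

  infix 4 _≈w_

  -- trace equivalence on words: equality in 𝒮Y
  data _≈w_ : List A → List A → Set where
    w-refl  : ∀ {u} → u ≈w u
    w-sym   : ∀ {u v} → u ≈w v → v ≈w u
    w-trans : ∀ {u v w} → u ≈w v → v ≈w w → u ≈w w
    w-swap  : ∀ {x y} u v → R x y → (u ++ x ∷ y ∷ v) ≈w (u ++ y ∷ x ∷ v)

  -- subsets of 𝒮Y, represented as predicates on representatives
  Language : Set₁
  Language = List A → Set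

  _·L_ : Language → Language → Language
  (P ·L Q) w = Σ (List A) λ u → Σ (List A) λ v → (w ≈w u ++ v) × P u × Q v

  powL : Language → ℕ → Language
  powL P zero w = w ≈w []
  powL P (suc n) = P ·L powL P n

  l : Tm A → Language
  l 𝟘 w = ⊥
  l 𝟙 w = w ≈w []
  l (var y) w = w ≈w [ y ]
  l (e ⊕ f) w = l e w ⊎ l f w
  l (e ⊗ f) = l e ·L l f
  l (e ⋆) w = Σ ℕ λ n → powL (l e) n w

  infix 4 _⊆L_
  _⊆L_ : Language → Language → Set
  P ⊆L Q = ∀ w → P w → Q w

-- Ÿ: left/right copies

Dbl : Set → Set
Dbl A = A ⊎ A

DblRel : ∀ {A : Set} → (A → A → Set) → Dbl A → Dbl A → Set
DblRel R (inj₁ x) (inj₁ y) = R x y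
DblRel R (inj₂ x) (inj₂ y) = R x y
DblRel R (inj₁ x) (inj₂ y) = ⊤
DblRel R (inj₂ x) (inj₁ y) = ⊤

_ₗ : ∀ {A} → Tm A → Tm (Dbl A)
e ₗ = subst (λ y → var (inj₁ y)) e

_ᵣ : ∀ {A} → Tm A → Tm (Dbl A)
e ᵣ = subst (λ y → var (inj₂ y)) e

dbl : ∀ {A} → Tm A → Tm (Dbl A)
dbl = subst (λ y → var (inj₁ y) ⊗ var (inj₂ y))

module Step {A : Set} (R : A → A → Set) where
  open Free (DblRel R) public using (_≈_; _≤_)

  _⟶[_]_ : List A → Tm (Dbl A) → List A → Set
  s ⟶[ e ] s' = (str s ₗ) ⊗ (str s' ᵣ) ≤ e

  _⟶[_]*_ : List A → Tm (Dbl A) → List A → Set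
  s ⟶[ e ]* s' = Star (λ u v → u ⟶[ e ] v) s s'

data Reg : Set where
  reg₁ reg₂ : Reg

data Instr (n : ℕ) : Set where
  Inc  : Reg → Fin n → Instr n
  If   : Reg → Fin n → Fin n → Instr n
  Halt : Fin 2 → Instr n

record TCM : Set where
  field
    n     : ℕ
    qinit : Fin n
    ι     : Fin n → Instr n

-- Σ_M = Q_M ⊎ {a, b, c₀, c₁}, discrete
data Sym (n : ℕ) : Set where
  st : Fin n → Sym n
  a b c₀ c₁ : Sym n

cOf : ∀ {n} → Fin 2 → Sym n
cOf Fin.zero = c₀
cOf (Fin.suc _) = c₁

_≟S_ : ∀ {n} → DecidableEquality (Sym n)
st p ≟S st q with p Fin.≟ q
... | yes refl = yes refl
... | no p≢q = no (λ { refl → p≢q refl })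
st p ≟S a = no (λ ())
a ≟S st p = no (λ ())
st p ≟S b = no (λ ())
b ≟S st p = no (λ ())
st p ≟S c₀ = no (λ ())
c₀ ≟S st p = no (λ ())
st p ≟S c₁ = no (λ ())
c₁ ≟S st p = no (λ ())
a ≟S a = yes refl
a ≟S b = no (λ ())
a ≟S c₀ = no (λ ())
a ≟S c₁ = no (λ ())
b ≟S a = no (λ ())
b ≟S b = yes refl
b ≟S c₀ = no (λ ())
b ≟S c₁ = no (λ ())
c₀ ≟S a = no (λ ())
c₀ ≟S b = no (λ ())
c₀ ≟S c₀ = yes refl
c₀ ≟S c₁ = no (λ ())
c₁ ≟S a = no (λ ())
c₁ ≟S b = no (λ ())
c₁ ≟S c₀ = no (λ ())
c₁ ≟S c₁ = yes refl

allSym : (n : ℕ) → List (Sym n)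
allSym n = map st (Data.List.allFin n) ++ (a ∷ b ∷ c₀ ∷ c₁ ∷ [])
  where import Data.List

module Machine (M : TCM) where
  open TCM M

  ΣS : Set
  ΣS = Sym n

  L' R' : ΣS → Tm (Dbl ΣS)
  L' x = var (inj₁ x)
  R' x = var (inj₂ x)

  D : ΣS → Tm (Dbl ΣS)
  D x = L' x ⊗ R' x

  QM : Tm ΣS
  QM = ∑ (map (λ q → var (st q)) (Data.List.allFin n))
    where import Data.List

  CM : Tm ΣS
  CM = (var a ⋆) ⊗ (var b ⋆) ⊗ QM

  TM : Tm ΣS
  TM = CM ⊕ var c₀ ⊕ var c₁

  ⟦_⟧ : Instr n → Tm (Dbl ΣS)
  ⟦ Inc reg₁ q ⟧ = R' a ⊗ (D a ⋆) ⊗ (D b ⋆) ⊗ R' (st q)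
  ⟦ Inc reg₂ q ⟧ = (D a ⋆) ⊗ R' b ⊗ (D b ⋆) ⊗ R' (st q)
  ⟦ If reg₁ q₁ q₂ ⟧ = (D b ⋆) ⊗ R' (st q₁) ⊕ L' a ⊗ (D a ⋆) ⊗ (D b ⋆) ⊗ R' (st q₂)
  ⟦ If reg₂ q₁ q₂ ⟧ = (D a ⋆) ⊗ R' (st q₁) ⊕ (D a ⋆) ⊗ L' b ⊗ (D b ⋆) ⊗ R' (st q₂)
  ⟦ Halt x ⟧ = R' (cOf x)

  RM : Tm (Dbl ΣS)
  RM = ∑ (map (λ q → ⟦ ι q ⟧ ⊗ L' (st q)) (Data.List.allFin n))
    where import Data.List

  ΣM* : Tm (Dbl ΣS)
  ΣM* = ∑ (map D (allSym n)) ⋆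

  Σ̈M* : Tm (Dbl ΣS)
  Σ̈M* = ∑ (map L' (allSym n) ++ map R' (allSym n)) ⋆

  ΣM≠ : Tm (Dbl ΣS)
  ΣM≠ = ∑ (map (λ p → L' (proj₁ p) ⊗ R' (proj₂ p))
              (filter (λ p → ¬? (proj₁ p ≟S proj₂ p))
                      (concatMap (λ x → map (λ y → (x , y)) (allSym n)) (allSym n))))

  Good : Tm (Dbl ΣS)
  Good = ΣM* ⊗ ((CM ⊕ var c₁) ᵣ) ⊕ ΣM* ⊗ ΣM≠ ⊗ Σ̈M*

-- A run s = s₀ → s₁ → ⋯ → sₖ = c_x is witnessed by the word
-- (s₀)ᵣ (s₀)ₗ(s₁)ᵣ ⋯ (sₖ₋₁)ₗ(sₖ)ᵣ of l(sᵣ R_M*), whose right projection is its left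
-- projection followed by c_x. Both projections are invariant under the commutations
-- of Σ̈_M, because two left letters commute only when they are equal. Words of Σ_M*
-- have equal projections. So a word of Σ_M* Σ_M^≠ Σ̈_M* cannot have this shape: right
-- after its Σ_M* prefix the projections show the two different letters of Σ_M^≠. In
-- a word of Σ_M* (C_M + c₁)ᵣ, the suffix projects to c_x on the right, and c₀ does
-- not occur in C_M + c₁.

module Submission where

open import Defs
open import Data.Fin using (Fin; zero; suc)
open import Data.List using (List; [_])
open import Relation.Binary.PropositionalEquality using (_≡_)

open import Data.Empty using (⊥-elim)
open import Data.List using ([]; _∷_; _++_; map; mapMaybe; filter; concatMap; allFin)
open import Data.List.Membership.Propositional using (find)
open import Data.List.Membership.Propositional.Properties using (∈-filter⁻)
open import Data.List.Properties
  using (++-assoc; ++-identityʳ; ++-cancelˡ; ∷-injectiveˡ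
        ; mapMaybe-++; mapMaybe-map; mapMaybe-just; mapMaybe-nothing)
open import Data.List.Relation.Unary.All using (All; []; _∷_; universal)
  renaming (head to All-head)
open import Data.List.Relation.Unary.All.Properties using (++⁺) renaming (map⁺ to All-map⁺)
open import Data.List.Relation.Unary.Any using (Any; here; there; satisfied)
open import Data.List.Relation.Unary.Any.Properties using () renaming (map⁻ to Any-map⁻)
open import Data.Maybe using (Maybe)
open import Data.Nat using (zero; suc)
open import Data.Product using (∃; ∃₂; _×_; _,_; proj₁; proj₂)
open import Data.Sum using (inj₁; inj₂; [_,_]′; isInj₁; isInj₂)
open import Data.Unit using (⊤; tt)
open import Function using (id; _∘_)
open import Relation.Binary.Construct.Closure.ReflexiveTransitive using (ε; _◅_)
open import Relation.Binary.Definitions using (_Respects_)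
import Relation.Binary.PropositionalEquality as ≡
open import Relation.Binary.PropositionalEquality
  using (_≢_; refl; sym; trans; cong; cong₂; subst₂; module ≡-Reasoning)
open import Relation.Nullary using (¬_; ¬?)
open import Relation.Unary using (Pred; Decidable; _⊆_; _≐_; _∪_)
open import Relation.Unary.Algebra using (∪-cong; ∪-comm; ∪-assoc; ∪-idem)
open import Relation.Unary.Properties using (≐-refl; ≐-sym; ≐-trans)

module TraceLanguages {A : Set} (R : A → A → Set) where
  open Lang R
  open Free R

  ≈w-reflexive : ∀ {u v} → u ≡ v → u ≈w v
  ≈w-reflexive refl = w-refl

  ++-congˡ : ∀ {u u′} v → u ≈w u′ → u ++ v ≈w u′ ++ v
  ++-congˡ v w-refl = w-refl
  ++-congˡ v (w-sym p) = w-sym (++-congˡ v p)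
  ++-congˡ v (w-trans p q) = w-trans (++-congˡ v p) (++-congˡ v q)
  ++-congˡ v (w-swap {x} {y} u v₀ r) =
    w-trans (≈w-reflexive (++-assoc u (x ∷ y ∷ v₀) v))
      (w-trans (w-swap u (v₀ ++ v) r) (≈w-reflexive (sym (++-assoc u (y ∷ x ∷ v₀) v))))

  ++-congʳ : ∀ u {v v′} → v ≈w v′ → u ++ v ≈w u ++ v′
  ++-congʳ u w-refl = w-refl
  ++-congʳ u (w-sym p) = w-sym (++-congʳ u p)
  ++-congʳ u (w-trans p q) = w-trans (++-congʳ u p) (++-congʳ u q)
  ++-congʳ u (w-swap {x} {y} u₀ v₀ r) =
    w-trans (≈w-reflexive (sym (++-assoc u u₀ (x ∷ y ∷ v₀))))
      (w-trans (w-swap (u ++ u₀) v₀ r) (≈w-reflexive (++-assoc u u₀ (y ∷ x ∷ v₀))))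

  ·L-resp : ∀ {P Q} → (P ·L Q) Respects _≈w_
  ·L-resp w≈w′ (u , v , w≈uv , p , q) = u , v , w-trans (w-sym w≈w′) w≈uv , p , q

  powL-resp : ∀ {P} n → powL P n Respects _≈w_
  powL-resp zero w≈w′ w≈[] = w-trans (w-sym w≈w′) w≈[]
  powL-resp (suc n) = ·L-resp

  l-resp : ∀ e → l e Respects _≈w_
  l-resp 𝟘 _ ()
  l-resp 𝟙 w≈w′ w≈[] = w-trans (w-sym w≈w′) w≈[]
  l-resp (var x) w≈w′ w≈[x] = w-trans (w-sym w≈w′) w≈[x]
  l-resp (e ⊕ f) w≈w′ = [ inj₁ ∘ l-resp e w≈w′ , inj₂ ∘ l-resp f w≈w′ ]′
  l-resp (e ⊗ f) = ·L-resp
  l-resp (e ⋆) w≈w′ (n , p) = n , powL-resp n w≈w′ p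

  ·L-mono : ∀ {P P′ Q Q′} → P ⊆ P′ → Q ⊆ Q′ → P ·L Q ⊆ P′ ·L Q′
  ·L-mono P⊆P′ Q⊆Q′ (u , v , w≈uv , p , q) = u , v , w≈uv , P⊆P′ p , Q⊆Q′ q

  ·L-cong : ∀ {P P′ Q Q′} → P ≐ P′ → Q ≐ Q′ → P ·L Q ≐ P′ ·L Q′
  ·L-cong (P⊆P′ , P′⊆P) (Q⊆Q′ , Q′⊆Q) = ·L-mono P⊆P′ Q⊆Q′ , ·L-mono P′⊆P Q′⊆Q

  powL-cong : ∀ {P Q} → P ≐ Q → ∀ n → powL P n ≐ powL Q n
  powL-cong P≐Q zero = ≐-refl
  powL-cong P≐Q (suc n) = ·L-cong P≐Q (powL-cong P≐Q n)

  l-⋆-cong : ∀ {e f} → l e ≐ l f → l (e ⋆) ≐ l (f ⋆)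
  l-⋆-cong e≐f =
    (λ (n , p) → n , proj₁ (powL-cong e≐f n) p) ,
    (λ (n , p) → n , proj₂ (powL-cong e≐f n) p)

  ·L-assoc : ∀ {P Q S} → (P ·L Q) ·L S ≐ P ·L (Q ·L S)
  ·L-assoc =
    (λ (_ , v , w≈u₁₂v , (u₁ , u₂ , u₁₂≈ , p , q) , s) →
      u₁ , u₂ ++ v ,
      w-trans w≈u₁₂v (w-trans (++-congˡ v u₁₂≈) (≈w-reflexive (++-assoc u₁ u₂ v))) ,
      p , (u₂ , v , w-refl , q , s)) ,
    (λ (u , _ , w≈uv₁₂ , p , (v₁ , v₂ , v₁₂≈ , q , s)) →
      u ++ v₁ , v₂ ,
      w-trans w≈uv₁₂ (w-trans (++-congʳ u v₁₂≈) (≈w-reflexive (sym (++-assoc u v₁ v₂)))) ,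
      (u , v₁ , w-refl , p , q) , s)

  ·L-identityˡ : ∀ {P} → P Respects _≈w_ → l 𝟙 ·L P ≐ P
  ·L-identityˡ P-resp =
    (λ (_ , v , w≈uv , u≈[] , p) → P-resp (w-sym (w-trans w≈uv (++-congˡ v u≈[]))) p) ,
    (λ p → [] , _ , w-refl , w-refl , p)

  ·L-identityʳ : ∀ {P} → P Respects _≈w_ → P ·L l 𝟙 ≐ P
  ·L-identityʳ P-resp =
    (λ (u , _ , w≈uv , p , v≈[]) →
      P-resp (w-sym (w-trans w≈uv (w-trans (++-congʳ u v≈[]) (≈w-reflexive (++-identityʳ u))))) p) ,
    (λ {w} p → w , [] , ≈w-reflexive (sym (++-identityʳ w)) , p , w-refl)

  ·L-distribˡ-∪ : ∀ {P Q S} → P ·L (Q ∪ S) ≐ (P ·L Q) ∪ (P ·L S)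
  ·L-distribˡ-∪ =
    (λ (u , v , w≈uv , p , q∪s) →
      [ (λ q → inj₁ (u , v , w≈uv , p , q)) , (λ s → inj₂ (u , v , w≈uv , p , s)) ]′ q∪s) ,
    [ ·L-mono id inj₁ , ·L-mono id inj₂ ]′

  ·L-distribʳ-∪ : ∀ {P Q S} → (Q ∪ S) ·L P ≐ (Q ·L P) ∪ (S ·L P)
  ·L-distribʳ-∪ =
    (λ (u , v , w≈uv , q∪s , p) →
      [ (λ q → inj₁ (u , v , w≈uv , q , p)) , (λ s → inj₂ (u , v , w≈uv , s , p)) ]′ q∪s) ,
    [ ·L-mono inj₁ id , ·L-mono inj₂ id ]′

  l-unfold : ∀ e → l (e ⋆) ≐ l (𝟙 ⊕ e ⊗ e ⋆)
  l-unfold e =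
    (λ { (zero , w≈[]) → inj₁ w≈[]
       ; (suc n , (u , v , w≈uv , p , q)) → inj₂ (u , v , w≈uv , p , (n , q)) }) ,
    [ (λ w≈[] → zero , w≈[])
    , (λ (u , v , w≈uv , p , (n , q)) → suc n , (u , v , w≈uv , p , q)) ]′

  l-comm : ∀ {x y} → R x y → l (var x ⊗ var y) ≐ l (var y ⊗ var x)
  l-comm r = swap-letters (w-swap [] _ r) , swap-letters (w-sym (w-swap [] _ r))
    where
    swap-letters : ∀ {x y} → (∀ {v} → x ∷ y ∷ v ≈w y ∷ x ∷ v) →
                   l (var x ⊗ var y) ⊆ l (var y ⊗ var x)
    swap-letters {x} {y} xy≈yx (_ , v , w≈uv , u≈[x] , v≈[y]) =
      [ y ] , [ x ] ,
      w-trans w≈uv (w-trans (++-congˡ v u≈[x]) (w-trans (++-congʳ [ x ] v≈[y]) xy≈yx)) ,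
      w-refl , w-refl

  l-sound : ∀ {e f} → e ≈ f → l e ≐ l f
  l-sound ≈-refl = ≐-refl
  l-sound (≈-sym e≈f) = ≐-sym (l-sound e≈f)
  l-sound (≈-trans e≈f f≈g) = ≐-trans (l-sound e≈f) (l-sound f≈g)
  l-sound (⊕-cong e≈e′ f≈f′) = ∪-cong (l-sound e≈e′) (l-sound f≈f′)
  l-sound (⊗-cong e≈e′ f≈f′) = ·L-cong (l-sound e≈e′) (l-sound f≈f′)
  l-sound (⋆-cong {e} {e′} e≈e′) = l-⋆-cong {e} {e′} (l-sound e≈e′)
  l-sound (⊕-assoc {e} {f} {g}) = ∪-assoc (l e) (l f) (l g)
  l-sound (⊕-comm {e} {f}) = ∪-comm (l e) (l f)
  l-sound (⊕-idem {e}) = ∪-idem (l e)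
  l-sound ⊕-idˡ = [ (λ ()) , id ]′ , inj₂
  l-sound ⊗-assoc = ·L-assoc
  l-sound (⊗-idˡ {e}) = ·L-identityˡ (l-resp e)
  l-sound (⊗-idʳ {e}) = ·L-identityʳ (l-resp e)
  l-sound distribˡ = ·L-distribˡ-∪
  l-sound distribʳ = ·L-distribʳ-∪
  l-sound zeroˡ = (λ ()) , (λ ())
  l-sound zeroʳ = (λ { (_ , _ , _ , _ , ()) }) , (λ ())
  l-sound (unfold {e}) = l-unfold e
  l-sound (comm r) = l-comm r

  l-mono : ∀ {e f} → e ≤ f → l e ⊆ l f
  l-mono e≤f = proj₁ (l-sound e≤f) ∘ inj₁

  l-∑⁻ : ∀ es {w} → l (∑ es) w → Any (λ e → l e w) es
  l-∑⁻ (e ∷ es) (inj₁ w∈e) = here w∈e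
  l-∑⁻ (e ∷ es) (inj₂ w∈es) = there (l-∑⁻ es w∈es)

  mapMaybe-resp-≈w : ∀ {B : Set} (f : A → Maybe B) →
    (∀ {x y} → R x y → mapMaybe f (x ∷ y ∷ []) ≡ mapMaybe f (y ∷ x ∷ [])) →
    ∀ {u v} → u ≈w v → mapMaybe f u ≡ mapMaybe f v
  mapMaybe-resp-≈w f f-swap w-refl = refl
  mapMaybe-resp-≈w f f-swap (w-sym p) = sym (mapMaybe-resp-≈w f f-swap p)
  mapMaybe-resp-≈w f f-swap (w-trans p q) =
    trans (mapMaybe-resp-≈w f f-swap p) (mapMaybe-resp-≈w f f-swap q)
  mapMaybe-resp-≈w f f-swap (w-swap {x} {y} u v r) = begin
    mapMaybe f (u ++ x ∷ y ∷ v)                               ≡⟨ splice (x ∷ y ∷ []) ⟩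
    mapMaybe f u ++ mapMaybe f (x ∷ y ∷ []) ++ mapMaybe f v
      ≡⟨ cong (λ m → mapMaybe f u ++ m ++ mapMaybe f v) (f-swap r) ⟩
    mapMaybe f u ++ mapMaybe f (y ∷ x ∷ []) ++ mapMaybe f v  ≡⟨ splice (y ∷ x ∷ []) ⟨
    mapMaybe f (u ++ y ∷ x ∷ v)                               ∎
    where
    open ≡-Reasoning
    splice : ∀ xs → mapMaybe f (u ++ xs ++ v) ≡ mapMaybe f u ++ mapMaybe f xs ++ mapMaybe f v
    splice xs = trans (mapMaybe-++ f u (xs ++ v)) (cong (mapMaybe f u ++_) (mapMaybe-++ f xs v))

module Projections {A : Set} where
  open Lang (DblRel {A} _≡_)
  open Step {A} _≡_ using (_⟶[_]*_)
  open TraceLanguages (DblRel {A} _≡_)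

  projₗ projᵣ : List (Dbl A) → List A
  projₗ = mapMaybe isInj₁
  projᵣ = mapMaybe isInj₂

  projₗ-++ : ∀ u v → projₗ (u ++ v) ≡ projₗ u ++ projₗ v
  projₗ-++ = mapMaybe-++ isInj₁

  projᵣ-++ : ∀ u v → projᵣ (u ++ v) ≡ projᵣ u ++ projᵣ v
  projᵣ-++ = mapMaybe-++ isInj₂

  projₗ-swap : ∀ {x y} → DblRel _≡_ x y → projₗ (x ∷ y ∷ []) ≡ projₗ (y ∷ x ∷ [])
  projₗ-swap {inj₁ _} {inj₁ _} refl = refl
  projₗ-swap {inj₁ _} {inj₂ _} _ = refl
  projₗ-swap {inj₂ _} {inj₁ _} _ = refl
  projₗ-swap {inj₂ _} {inj₂ _} _ = refl

  projᵣ-swap : ∀ {x y} → DblRel _≡_ x y → projᵣ (x ∷ y ∷ []) ≡ projᵣ (y ∷ x ∷ [])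
  projᵣ-swap {inj₁ _} {inj₁ _} _ = refl
  projᵣ-swap {inj₁ _} {inj₂ _} _ = refl
  projᵣ-swap {inj₂ _} {inj₁ _} _ = refl
  projᵣ-swap {inj₂ _} {inj₂ _} refl = refl

  projₗ-resp-≈w : ∀ {u v} → u ≈w v → projₗ u ≡ projₗ v
  projₗ-resp-≈w = mapMaybe-resp-≈w isInj₁ (λ {x} {y} → projₗ-swap {x} {y})

  projᵣ-resp-≈w : ∀ {u v} → u ≈w v → projᵣ u ≡ projᵣ v
  projᵣ-resp-≈w = mapMaybe-resp-≈w isInj₂ (λ {x} {y} → projᵣ-swap {x} {y})

  projₗ-· : ∀ {w} u v → w ≈w u ++ v → projₗ w ≡ projₗ u ++ projₗ v
  projₗ-· u v w≈uv = trans (projₗ-resp-≈w w≈uv) (projₗ-++ u v)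

  projᵣ-· : ∀ {w} u v → w ≈w u ++ v → projᵣ w ≡ projᵣ u ++ projᵣ v
  projᵣ-· u v w≈uv = trans (projᵣ-resp-≈w w≈uv) (projᵣ-++ u v)

  projₗ-map-inj₁ : ∀ s → projₗ (map inj₁ s) ≡ s
  projₗ-map-inj₁ s = trans (mapMaybe-map isInj₁ inj₁ s) (mapMaybe-just s)

  projₗ-map-inj₂ : ∀ s → projₗ (map inj₂ s) ≡ []
  projₗ-map-inj₂ s = trans (mapMaybe-map isInj₁ inj₂ s) (mapMaybe-nothing s)

  projᵣ-map-inj₁ : ∀ s → projᵣ (map inj₁ s) ≡ []
  projᵣ-map-inj₁ s = trans (mapMaybe-map isInj₂ inj₁ s) (mapMaybe-nothing s)

  projᵣ-map-inj₂ : ∀ s → projᵣ (map inj₂ s) ≡ s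
  projᵣ-map-inj₂ s = trans (mapMaybe-map isInj₂ inj₂ s) (mapMaybe-just s)

  module ProjectionInvariant
    (Φ : List A → List A → Set)
    (Φ-[] : Φ [] [])
    (Φ-++ : ∀ {u₁ u₂ v₁ v₂} → Φ u₁ u₂ → Φ v₁ v₂ → Φ (u₁ ++ v₁) (u₂ ++ v₂))
    where

    Holds : Pred (List (Dbl A)) _
    Holds w = Φ (projₗ w) (projᵣ w)

    Holds-resp : Holds Respects _≈w_
    Holds-resp u≈v = subst₂ Φ (projₗ-resp-≈w u≈v) (projᵣ-resp-≈w u≈v)

    Holds-[] : ∀ {w} → w ≈w [] → Holds w
    Holds-[] w≈[] = Holds-resp (w-sym w≈[]) Φ-[]

    ·L-⊆ : ∀ {P Q} → P ⊆ Holds → Q ⊆ Holds → P ·L Q ⊆ Holds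
    ·L-⊆ P⊆Φ Q⊆Φ (u , v , w≈uv , p , q) =
      Holds-resp (w-sym w≈uv)
        (subst₂ Φ (sym (projₗ-++ u v)) (sym (projᵣ-++ u v)) (Φ-++ (P⊆Φ p) (Q⊆Φ q)))

    powL-⊆ : ∀ {P} → P ⊆ Holds → ∀ n → powL P n ⊆ Holds
    powL-⊆ P⊆Φ zero = Holds-[]
    powL-⊆ P⊆Φ (suc n) = ·L-⊆ P⊆Φ (powL-⊆ P⊆Φ n)

    l-⋆-⊆ : ∀ {e} → l e ⊆ Holds → l (e ⋆) ⊆ Holds
    l-⋆-⊆ e⊆Φ (n , p) = powL-⊆ e⊆Φ n p

  module Balanced = ProjectionInvariant _≡_ refl (cong₂ _++_)

  RightTracks : (A → Set) → List A → List A → Set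
  RightTracks Q u v = u ≡ [] × All Q v

  RightTracks-++ : ∀ {Q u₁ u₂ v₁ v₂} → RightTracks Q u₁ u₂ → RightTracks Q v₁ v₂ →
                   RightTracks Q (u₁ ++ v₁) (u₂ ++ v₂)
  RightTracks-++ (refl , Q-u₂) (refl , Q-v₂) = refl , ++⁺ Q-u₂ Q-v₂

  module RightOnly (Q : A → Set) = ProjectionInvariant (RightTracks Q) (refl , []) RightTracks-++

  AllVars : (A → Set) → Tm A → Set
  AllVars Q 𝟘 = ⊤
  AllVars Q 𝟙 = ⊤
  AllVars Q (var x) = Q x
  AllVars Q (e ⊕ f) = AllVars Q e × AllVars Q f
  AllVars Q (e ⊗ f) = AllVars Q e × AllVars Q f
  AllVars Q (e ⋆) = AllVars Q e

  AllVars-∑ : ∀ {Q es} → All (AllVars Q) es → AllVars Q (∑ es)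
  AllVars-∑ [] = tt
  AllVars-∑ (Qe ∷ Qes) = Qe , AllVars-∑ Qes

  l-ᵣ-⊆ : ∀ {Q} e → AllVars Q e → l (e ᵣ) ⊆ RightOnly.Holds Q
  l-ᵣ-⊆ 𝟘 _ ()
  l-ᵣ-⊆ {Q} 𝟙 _ = RightOnly.Holds-[] Q
  l-ᵣ-⊆ {Q} (var x) Qx w≈[x] = RightOnly.Holds-resp Q (w-sym w≈[x]) (refl , Qx ∷ [])
  l-ᵣ-⊆ (e ⊕ f) (Qe , Qf) = [ l-ᵣ-⊆ e Qe , l-ᵣ-⊆ f Qf ]′
  l-ᵣ-⊆ {Q} (e ⊗ f) (Qe , Qf) = RightOnly.·L-⊆ Q (l-ᵣ-⊆ e Qe) (l-ᵣ-⊆ f Qf)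
  l-ᵣ-⊆ {Q} (e ⋆) Qe = RightOnly.l-⋆-⊆ Q {e ᵣ} (l-ᵣ-⊆ e Qe)

  lr-letters : ∀ {x y w} → l (var (inj₁ x) ⊗ var (inj₂ y)) w →
               projₗ w ≡ [ x ] × projᵣ w ≡ [ y ]
  lr-letters (u , v , w≈uv , u≈x , v≈y) =
    trans (projₗ-· u v w≈uv) (cong₂ _++_ (projₗ-resp-≈w u≈x) (projₗ-resp-≈w v≈y)) ,
    trans (projᵣ-· u v w≈uv) (cong₂ _++_ (projᵣ-resp-≈w u≈x) (projᵣ-resp-≈w v≈y))

  map-inj₁∈strₗ : ∀ s → l (str s ₗ) (map inj₁ s)
  map-inj₁∈strₗ [] = w-refl
  map-inj₁∈strₗ (x ∷ s) = [ inj₁ x ] , map inj₁ s , w-refl , w-refl , map-inj₁∈strₗ s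

  map-inj₂∈strᵣ : ∀ s → l (str s ᵣ) (map inj₂ s)
  map-inj₂∈strᵣ [] = w-refl
  map-inj₂∈strᵣ (x ∷ s) = [ inj₂ x ] , map inj₂ s , w-refl , w-refl , map-inj₂∈strᵣ s

  projₗ-step : ∀ s s′ v → projₗ ((map inj₁ s ++ map inj₂ s′) ++ v) ≡ s ++ projₗ v
  projₗ-step s s′ v = begin
    projₗ ((map inj₁ s ++ map inj₂ s′) ++ v)
      ≡⟨ projₗ-++ (map inj₁ s ++ map inj₂ s′) v ⟩
    projₗ (map inj₁ s ++ map inj₂ s′) ++ projₗ v
      ≡⟨ cong (_++ projₗ v) (projₗ-++ (map inj₁ s) (map inj₂ s′)) ⟩
    (projₗ (map inj₁ s) ++ projₗ (map inj₂ s′)) ++ projₗ v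
      ≡⟨ cong (_++ projₗ v) (cong₂ _++_ (projₗ-map-inj₁ s) (projₗ-map-inj₂ s′)) ⟩
    (s ++ []) ++ projₗ v
      ≡⟨ cong (_++ projₗ v) (++-identityʳ s) ⟩
    s ++ projₗ v ∎
    where open ≡-Reasoning

  projᵣ-step : ∀ s s′ v → projᵣ ((map inj₁ s ++ map inj₂ s′) ++ v) ≡ s′ ++ projᵣ v
  projᵣ-step s s′ v = begin
    projᵣ ((map inj₁ s ++ map inj₂ s′) ++ v)
      ≡⟨ projᵣ-++ (map inj₁ s ++ map inj₂ s′) v ⟩
    projᵣ (map inj₁ s ++ map inj₂ s′) ++ projᵣ v
      ≡⟨ cong (_++ projᵣ v) (projᵣ-++ (map inj₁ s) (map inj₂ s′)) ⟩
    (projᵣ (map inj₁ s) ++ projᵣ (map inj₂ s′)) ++ projᵣ v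
      ≡⟨ cong (_++ projᵣ v) (cong₂ _++_ (projᵣ-map-inj₁ s) (projᵣ-map-inj₂ s′)) ⟩
    s′ ++ projᵣ v ∎
    where open ≡-Reasoning

  run-word : ∀ {e s t} → s ⟶[ e ]* t → ∃ λ v → l (e ⋆) v × projₗ v ++ t ≡ s ++ projᵣ v
  run-word {s = s} ε = [] , (zero , w-refl) , sym (++-identityʳ s)
  run-word {s = s} {t} (_◅_ {j = s′} s⟶s′ run) =
    let v , (k , v∈eᵏ) , v-shift = run-word run
        m = map inj₁ s ++ map inj₂ s′
        m∈e = l-mono s⟶s′ (map inj₁ s , map inj₂ s′ , w-refl , map-inj₁∈strₗ s , map-inj₂∈strᵣ s′)
    in m ++ v , (suc k , m , v , w-refl , m∈e , v∈eᵏ) , (begin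
      projₗ (m ++ v) ++ t    ≡⟨ cong (_++ t) (projₗ-step s s′ v) ⟩
      (s ++ projₗ v) ++ t    ≡⟨ ++-assoc s (projₗ v) t ⟩
      s ++ projₗ v ++ t      ≡⟨ cong (s ++_) v-shift ⟩
      s ++ s′ ++ projᵣ v     ≡⟨ cong (s ++_) (projᵣ-step s s′ v) ⟨
      s ++ projᵣ (m ++ v)    ∎)
    where open ≡-Reasoning

  Shifted : List A → List (Dbl A) → Set
  Shifted t w = projᵣ w ≡ projₗ w ++ t

  seeded-run-word : ∀ {e s t} → s ⟶[ e ]* t → ∃ λ w → l (str s ᵣ ⊗ e ⋆) w × Shifted t w
  seeded-run-word {s = s} {t} run =
    let v , v∈e⋆ , v-shift = run-word run
    in map inj₂ s ++ v , (map inj₂ s , v , w-refl , map-inj₂∈strᵣ s , v∈e⋆) , (begin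
      projᵣ (map inj₂ s ++ v)       ≡⟨ projᵣ-step [] s v ⟩
      s ++ projᵣ v                  ≡⟨ v-shift ⟨
      projₗ v ++ t                  ≡⟨ cong (_++ t) (projₗ-step [] s v) ⟨
      projₗ (map inj₂ s ++ v) ++ t  ∎)
    where open ≡-Reasoning

  balanced-prefix-shifted : ∀ {t u v w} → Balanced.Holds u → w ≈w u ++ v →
                            Shifted t w → Shifted t v
  balanced-prefix-shifted {t} {u} {v} {w} u-bal w≈uv w-shift = ++-cancelˡ (projₗ u) _ _ (begin
    projₗ u ++ projᵣ v         ≡⟨ cong (_++ projᵣ v) u-bal ⟩
    projᵣ u ++ projᵣ v         ≡⟨ projᵣ-· u v w≈uv ⟨
    projᵣ w                    ≡⟨ w-shift ⟩
    projₗ w ++ t               ≡⟨ cong (_++ t) (projₗ-· u v w≈uv) ⟩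
    (projₗ u ++ projₗ v) ++ t  ≡⟨ ++-assoc (projₗ u) (projₗ v) t ⟩
    projₗ u ++ projₗ v ++ t    ∎)
    where open ≡-Reasoning

  right-only-shifted : ∀ {Q t v} → RightOnly.Holds Q v → Shifted t v → All Q t
  right-only-shifted {Q} {t} (vₗ≡[] , Q-vᵣ) v-shift =
    ≡.subst (All Q) (trans v-shift (cong (_++ t) vₗ≡[])) Q-vᵣ

  Mismatched : List (Dbl A) → Set
  Mismatched m = ∃₂ λ x y → x ≢ y × projₗ m ≡ [ x ] × projᵣ m ≡ [ y ]

  mismatched-¬shifted : ∀ {t m z} → Mismatched m → ¬ Shifted t (m ++ z)
  mismatched-¬shifted {t} {m} {z} (x , y , x≢y , mₗ , mᵣ) mz-shift =
    x≢y (sym (∷-injectiveˡ (begin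
      y ∷ projᵣ z                ≡⟨ cong (_++ projᵣ z) mᵣ ⟨
      projᵣ m ++ projᵣ z         ≡⟨ projᵣ-++ m z ⟨
      projᵣ (m ++ z)             ≡⟨ mz-shift ⟩
      projₗ (m ++ z) ++ t        ≡⟨ cong (_++ t) (projₗ-++ m z) ⟩
      (projₗ m ++ projₗ z) ++ t  ≡⟨ cong (λ p → (p ++ projₗ z) ++ t) mₗ ⟩
      x ∷ projₗ z ++ t           ∎)))
    where open ≡-Reasoning

module MachineWords (M : TCM) where
  open TCM M
  open Machine M
  open Lang (DblRel {ΣS} _≡_)
  open TraceLanguages (DblRel {ΣS} _≡_)
  open Projections {ΣS}

  ΣM*-balanced : l ΣM* ⊆ Balanced.Holds
  ΣM*-balanced = Balanced.l-⋆-⊆ {∑ (map D (allSym n))} λ w∈ΣM →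
    let _ , w∈Dx = satisfied (Any-map⁻ (l-∑⁻ (map D (allSym n)) w∈ΣM))
        wₗ , wᵣ = lr-letters w∈Dx
    in trans wₗ (sym wᵣ)

  symbolPairs : List (ΣS × ΣS)
  symbolPairs = concatMap (λ x → map (x ,_) (allSym n)) (allSym n)

  distinct? : Decidable λ (p : ΣS × ΣS) → proj₁ p ≢ proj₂ p
  distinct? p = ¬? (proj₁ p ≟S proj₂ p)

  ΣM≠-mismatched : l ΣM≠ ⊆ Mismatched
  ΣM≠-mismatched w∈ΣM≠ with find (Any-map⁻ (l-∑⁻ (map _ (filter distinct? symbolPairs)) w∈ΣM≠))
  ... | (x , y) , xy∈ , w∈xy =
    x , y , proj₂ (∈-filter⁻ distinct? {xs = symbolPairs} xy∈) , lr-letters w∈xy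

  CM⊕c₁-avoids-c₀ : AllVars (_≢ c₀) (CM ⊕ var c₁)
  CM⊕c₁-avoids-c₀ =
    (((λ ()) , (λ ())) , AllVars-∑ (All-map⁺ (universal (λ _ ()) (allFin n)))) , (λ ())

  cOf≢c₀⇒≡1 : ∀ x → cOf {n} x ≢ c₀ → x ≡ suc zero
  cOf≢c₀⇒≡1 zero c₀≢c₀ = ⊥-elim (c₀≢c₀ refl)
  cOf≢c₀⇒≡1 (suc zero) _ = refl

  good-shifted⇒c₁ : ∀ {w x} → l Good w → Shifted [ cOf x ] w → x ≡ suc zero
  good-shifted⇒c₁ {x = x} (inj₁ (u , v , w≈uv , u∈ΣM* , v∈CM⊕c₁)) w-shift =
    cOf≢c₀⇒≡1 x (All-head (right-only-shifted {v = v}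
      (l-ᵣ-⊆ (CM ⊕ var c₁) CM⊕c₁-avoids-c₀ v∈CM⊕c₁)
      (balanced-prefix-shifted {u = u} (ΣM*-balanced u∈ΣM*) w≈uv w-shift)))
  good-shifted⇒c₁ (inj₂ (_ , z , w≈u′z , (u , m , u′≈um , u∈ΣM* , m∈ΣM≠) , _)) w-shift =
    ⊥-elim (mismatched-¬shifted {m = m} {z} (ΣM≠-mismatched m∈ΣM≠)
      (balanced-prefix-shifted {u = u} (ΣM*-balanced u∈ΣM*) w≈u[mz] w-shift))
    where
    w≈u[mz] : _ ≈w u ++ m ++ z
    w≈u[mz] = w-trans w≈u′z (w-trans (++-congˡ z u′≈um) (≈w-reflexive (++-assoc u m z)))

mainTheorem2 : (M : TCM) (s : List (Sym (TCM.n M)))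
    → Free._≤_ {Sym (TCM.n M)} _≡_ (str s) (Machine.TM M)
    → Lang._⊆L_ (DblRel {Sym (TCM.n M)} _≡_)
        (Lang.l (DblRel _≡_) ((str s ᵣ) ⊗ (Machine.RM M ⋆)))
        (Lang.l (DblRel _≡_) (Machine.Good M))
    → (x : Fin 2)
    → Step._⟶[_]*_ {Sym (TCM.n M)} _≡_ s (Machine.RM M) [ cOf x ]
    → x ≡ suc zero
mainTheorem2 M s _ s·RM*⊆Good x run =
  let w , w∈s·RM* , w-shift = Projections.seeded-run-word run
  in MachineWords.good-shifted⇒c₁ M (s·RM*⊆Good w w∈s·RM*) w-shift
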